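{- Let $n\geq2$, $k\geq1$ and let $uv$ be any edge of the DCell $D_{k,n}$. If $uv$ is a level $0$ edge, then $u$ and $v$ have exactly $n-2$ common neighbors; if $uv$ is a level $j$ edge with $1\leq j\leq k$, then $u$ and $v$ have no common neighbors.
   Context: DCell $D_{k,n}$ ($n\geq 2$, $k\geq 0$) is defined recursively. $D_{0,n}$ is the complete graph $K_n$ on vertices $0,1,\dots,n-1$. Let $t_{k,n}=|V(D_{k,n})|$. For $k\geq1$, $D_{k,n}$ is built from $t_{k-1,n}+1$ disjoint copies $D^0_{k-1,n},\dots,D^{t_{k-1,n}}_{k-1,n}$ of $D_{k-1,n}$; a vertex of copy $D^i_{k-1,n}$ is labeled $(i,a_{k-1},\dots,a_0)$, where $(a_{k-1},\dots,a_0)$ is its label in $D_{k-1,n}$, and its index within the copy is $uid_{k-1}=a_0+\sum_{l=1}^{k-1}a_l t_{l-1,n}$. For each pair $a<b$ of copy indices, one new edge (a level $k$ edge) joins the vertex of $D^a_{k-1,n}$ with $uid_{k-1}=b-1$ to the vertex of $D^b_{k-1,n}$ with $uid_{k-1}=a$. Edges of the base copies of $K_n$ are level $0$ edges; edges added at step $j$ of the recursion are level $j$ edges. -}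

module Defs where

open import Data.Nat using (ℕ; zero; suc; _+_; _*_; _∸_; _<_; _≤_)
open import Data.Product using (∃; _×_)
open import Relation.Binary.PropositionalEquality using (_≢_)

-- t k n = |V(D_{k,n})| :  t_{0,n} = n,  t_{k,n} = t_{k-1,n} (t_{k-1,n} + 1)
t : ℕ → ℕ → ℕ
t zero    n = n
t (suc k) n = t k n * suc (t k n)

-- Vertices of D_{k,n} are identified with their uid_k ∈ {0,…,t k n - 1}.
-- A vertex (i, a_{k-1},…,a_0) of copy D^i_{k-1,n} has uid_k = i * t_{k-1,n} + uid_{k-1}.
-- Edge k n x y j : "x y is a level-j edge of D_{k,n}" (x, y given by their uids).
data Edge : ℕ → ℕ → ℕ → ℕ → ℕ → Set where
  base : ∀ {n x y} → x < n → y < n → x ≢ y → Edge zero n x y zero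
  copy : ∀ {k n x y j} (i : ℕ) → i ≤ t k n → Edge k n x y j →
         Edge (suc k) n (i * t k n + x) (i * t k n + y) j
  newˡ : ∀ {k n} (a b : ℕ) → a < b → b ≤ t k n →
         Edge (suc k) n (a * t k n + (b ∸ 1)) (b * t k n + a) (suc k)
  newʳ : ∀ {k n} (a b : ℕ) → a < b → b ≤ t k n →
         Edge (suc k) n (b * t k n + a) (a * t k n + (b ∸ 1)) (suc k)

Adj : ℕ → ℕ → ℕ → ℕ → Set
Adj k n x y = ∃ λ j → Edge k n x y j

CommonNbr : ℕ → ℕ → ℕ → ℕ → ℕ → Set
CommonNbr k n u v w = Adj k n u w × Adj k n v w

-- A level-(k+1) edge of D_{k+1,n} joins two different copies of D_{k,n}, and every vertex is
-- an end of at most one such edge.  So a triangle cannot contain two of them (they would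
-- share a vertex), nor exactly one (its other two edges would lie inside copies, putting
-- both ends of the bridge into one copy); by induction every triangle lies in one of the
-- base copies of K_n.  Hence an edge of level j ≥ 1 has no common neighbours, while the
-- common neighbours of a level-0 edge pq are the n - 2 other vertices of its K_n.

module Submission where

open import Defs
open import Data.Nat using (ℕ; _≤_; _∸_)
open import Data.Product using (Σ; _×_)
open import Data.List using (List; length)
open import Data.List.Membership.Propositional using (_∈_)
open import Data.List.Relation.Unary.Unique.Propositional using (Unique)
open import Data.Empty using (⊥)
open import Relation.Binary.PropositionalEquality using (_≡_)
open import Function.Bundles using (_⇔_)

open import Data.Nat using (zero; suc; _+_; _*_; _<_; z≤n; s≤s; s≤s⁻¹; _≟_)
open import Data.Nat.Properties
open import Data.Nat.DivMod using (_/_; _%_; m≡m%n+[m/n]*n; m%n<n; m<n*o⇒m/o<n)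
open import Data.Nat.Tactic.RingSolver using (solve-∀)
open import Data.Empty using (⊥-elim)
open import Data.Product using (∃-syntax; _,_; proj₁; proj₂)
open import Data.List using (_∷_; map; filter; upTo)
open import Data.List.Properties using (length-map; length-upTo; filter-accept; filter-reject; filter-all)
open import Data.List.Membership.Propositional.Properties
  using (∈-map⁺; ∈-map⁻; ∈-filter⁺; ∈-filter⁻; ∈-upTo⁺; ∈-upTo⁻)
open import Data.List.Relation.Unary.Any using (here; there)
open import Data.List.Relation.Unary.All as All using ()
open import Data.List.Relation.Unary.AllPairs using (_∷_)
open import Data.List.Relation.Unary.Unique.Propositional.Properties using (map⁺; filter⁺; upTo⁺)
open import Relation.Nullary using (¬?; contradiction)
open import Relation.Binary.Definitions using (DecidableEquality)
open import Relation.Binary.PropositionalEquality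
  using (refl; sym; trans; cong; subst; subst₂; _≢_; ≢-sym; module ≡-Reasoning)
open import Function.Bundles using (mk⇔)
open import Function.Properties.Equivalence using () renaming (trans to ⇔-trans)

mixed-radix-< : ∀ {i x C N} → i ≤ N → x < C → i * C + x < C * suc N
mixed-radix-< {i} {x} {C} {N} i≤N x<C = begin-strict
  i * C + x <⟨ +-monoʳ-< (i * C) x<C ⟩
  i * C + C ≡⟨ +-comm (i * C) C ⟩
  suc i * C ≤⟨ *-monoˡ-≤ C (s≤s i≤N) ⟩
  suc N * C ≡⟨ *-comm (suc N) C ⟩
  C * suc N ∎
  where open ≤-Reasoning

mixed-radix-injective : ∀ N i i′ {x x′} → x < N → x′ < N →
                        i * N + x ≡ i′ * N + x′ → i ≡ i′ × x ≡ x′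
mixed-radix-injective N zero    zero     _   _    eq = refl , eq
mixed-radix-injective N zero    (suc i′) x<N _    eq =
  contradiction (subst (N ≤_) (sym eq) (≤-trans (m≤m+n N _) (m≤m+n _ _))) (<⇒≱ x<N)
mixed-radix-injective N (suc i) zero     _   x′<N eq =
  contradiction (subst (N ≤_) eq (≤-trans (m≤m+n N _) (m≤m+n _ _))) (<⇒≱ x′<N)
mixed-radix-injective N (suc i) (suc i′) x<N x′<N eq
  with mixed-radix-injective N i i′ x<N x′<N
         (+-cancelˡ-≡ N _ _ (trans (sym (+-assoc N _ _)) (trans eq (+-assoc N _ _))))
... | i≡i′ , x≡x′ = cong suc i≡i′ , x≡x′

mixed-radix-split : ∀ {m C N} → m < C * suc N → ∃[ i ] ∃[ x ] i ≤ N × x < C × m ≡ i * C + x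
mixed-radix-split {m} {suc C} {N} m<CN =
  m / suc C , m % suc C ,
  s≤s⁻¹ (m<n*o⇒m/o<n (subst (m <_) (*-comm (suc C) (suc N)) m<CN)) ,
  m%n<n m (suc C) ,
  trans (m≡m%n+[m/n]*n m (suc C)) (+-comm (m % suc C) _)

edge-sym : ∀ {k n x y j} → Edge k n x y j → Edge k n y x j
edge-sym (base x<n y<n x≢y) = base y<n x<n (≢-sym x≢y)
edge-sym (copy i i≤t e)     = copy i i≤t (edge-sym e)
edge-sym (newˡ a b a<b b≤t) = newʳ a b a<b b≤t
edge-sym (newʳ a b a<b b≤t) = newˡ a b a<b b≤t

edge-bounded : ∀ {k n x y j} → Edge k n x y j → x < t k n × y < t k n
edge-bounded (base x<n y<n _) = x<n , y<n
edge-bounded (copy i i≤t e) with edge-bounded e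
... | x<t , y<t = mixed-radix-< i≤t x<t , mixed-radix-< i≤t y<t
edge-bounded (newˡ a (suc c) (s≤s a≤c) c<t) =
  mixed-radix-< (≤-trans a≤c (<⇒≤ c<t)) c<t , mixed-radix-< c<t (≤-<-trans a≤c c<t)
edge-bounded (newʳ a (suc c) (s≤s a≤c) c<t) =
  mixed-radix-< c<t (≤-<-trans a≤c c<t) , mixed-radix-< (≤-trans a≤c (<⇒≤ c<t)) c<t

data InCopy (k n i u : ℕ) : Set where
  offset : ∀ x → x < t k n → u ≡ i * t k n + x → InCopy k n i u

inCopy-unique : ∀ {k n i i′ u} → InCopy k n i u → InCopy k n i′ u → i ≡ i′
inCopy-unique {k} {n} {i} {i′} (offset x x<t refl) (offset x′ x′<t eq) =
  proj₁ (mixed-radix-injective (t k n) i i′ x<t x′<t eq)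

data SameCopy (k n u w : ℕ) : Set where
  both : ∀ i → InCopy k n i u → InCopy k n i w → SameCopy k n u w

sameCopy-sym : ∀ {k n u w} → SameCopy k n u w → SameCopy k n w u
sameCopy-sym (both i u∈i w∈i) = both i w∈i u∈i

sameCopy-trans : ∀ {k n u v w} → SameCopy k n u v → SameCopy k n v w → SameCopy k n u w
sameCopy-trans {k} {n} {w = w} (both i u∈i v∈i) (both i′ v∈i′ w∈i′) =
  both i u∈i (subst (λ c → InCopy k n c w) (sym (inCopy-unique v∈i v∈i′)) w∈i′)

-- The level-(k+1) edge joining vertex c of copy a to vertex a of copy c + 1
-- (the paper's b is c + 1), in either orientation.
data Bridge (k n u w : ℕ) : Set where
  up   : ∀ a c → a ≤ c → c < t k n →
         u ≡ a * t k n + c → w ≡ suc c * t k n + a → Bridge k n u w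
  down : ∀ a c → a ≤ c → c < t k n →
         u ≡ suc c * t k n + a → w ≡ a * t k n + c → Bridge k n u w

bridge-sym : ∀ {k n u w} → Bridge k n u w → Bridge k n w u
bridge-sym (up   a c a≤c c<t eu ew) = down a c a≤c c<t ew eu
bridge-sym (down a c a≤c c<t eu ew) = up   a c a≤c c<t ew eu

bridge-ends : ∀ {k n u w} → Bridge k n u w →
              ∃[ a ] ∃[ b ] a ≢ b × InCopy k n a u × InCopy k n b w
bridge-ends (up a c a≤c c<t eu ew) =
  a , suc c , <⇒≢ (s≤s a≤c) , offset c c<t eu , offset a (≤-<-trans a≤c c<t) ew
bridge-ends (down a c a≤c c<t eu ew) =
  suc c , a , ≢-sym (<⇒≢ (s≤s a≤c)) , offset a (≤-<-trans a≤c c<t) eu , offset c c<t ew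

bridge-leaves-copy : ∀ {k n u w} → Bridge k n u w → SameCopy k n u w → ⊥
bridge-leaves-copy br (both i u∈i w∈i) with bridge-ends br
... | a , b , a≢b , u∈a , w∈b =
  a≢b (trans (sym (inCopy-unique u∈i u∈a)) (inCopy-unique w∈i w∈b))

bridge-irreflexive : ∀ {k n u w} → Bridge k n u w → u ≢ w
bridge-irreflexive br refl with bridge-ends br
... | a , _ , _ , u∈a , _ = bridge-leaves-copy br (both a u∈a u∈a)

-- Vertex c of copy a is the lower end of its bridge if a ≤ c and the upper end if c < a.
lower-end≢upper-end : ∀ N {a c a′ c′} → a ≤ c → c < N → a′ ≤ c′ → c′ < N →
                      a * N + c ≢ suc c′ * N + a′
lower-end≢upper-end N {a} {c} {a′} {c′} a≤c c<N a′≤c′ c′<N eq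
  with mixed-radix-injective N a (suc c′) c<N (≤-<-trans a′≤c′ c′<N) eq
... | refl , refl = <-irrefl refl (≤-trans a≤c a′≤c′)

bridge-unique : ∀ {k n u w w′} → Bridge k n u w → Bridge k n u w′ → w ≡ w′
bridge-unique {k} {n} (up a _ _ c<t eu ew) (up a′ _ _ c′<t eu′ ew′)
  with mixed-radix-injective (t k n) a a′ c<t c′<t (trans (sym eu) eu′)
... | refl , refl = trans ew (sym ew′)
bridge-unique {k} {n} (up _ _ a≤c c<t eu _) (down _ _ a′≤c′ c′<t eu′ _) =
  contradiction (trans (sym eu) eu′) (lower-end≢upper-end (t k n) a≤c c<t a′≤c′ c′<t)
bridge-unique {k} {n} (down _ _ a≤c c<t eu _) (up _ _ a′≤c′ c′<t eu′ _) =
  contradiction (trans (sym eu′) eu) (lower-end≢upper-end (t k n) a′≤c′ c′<t a≤c c<t)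
bridge-unique {k} {n} (down _ c a≤c c<t eu ew) (down _ c′ a′≤c′ c′<t eu′ ew′)
  with mixed-radix-injective (t k n) (suc c) (suc c′) (≤-<-trans a≤c c<t) (≤-<-trans a′≤c′ c′<t)
         (trans (sym eu) eu′)
... | refl , refl = trans ew (sym ew′)

data Split (k n u w j : ℕ) : Set where
  within : ∀ i x y → Edge k n x y j → u ≡ i * t k n + x → w ≡ i * t k n + y → Split k n u w j
  bridge : Bridge k n u w → Split k n u w j

split : ∀ {k n u w j} → Edge (suc k) n u w j → Split k n u w j
split (copy i _ e)                   = within i _ _ e refl refl
split (newˡ a (suc c) (s≤s a≤c) c<t) = bridge (up a c a≤c c<t refl refl)
split (newʳ a (suc c) (s≤s a≤c) c<t) = bridge (down a c a≤c c<t refl refl)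

copy-edge-sameCopy : ∀ {k n u w x y j} i → Edge k n x y j →
                     u ≡ i * t k n + x → w ≡ i * t k n + y → SameCopy k n u w
copy-edge-sameCopy i e eu ew with edge-bounded e
... | x<t , y<t = both i (offset _ x<t eu) (offset _ y<t ew)

edge-irreflexive : ∀ {k n x y j} → Edge k n x y j → x ≢ y
edge-irreflexive {zero} (base _ _ x≢y) = x≢y
edge-irreflexive {suc k} e with split e
... | within i x y e′ refl refl = λ eq → edge-irreflexive e′ (+-cancelˡ-≡ (i * t k _) x y eq)
... | bridge br = bridge-irreflexive br

triangle⇒level0 : ∀ k {n u v w j j₁ j₂} →
                  Edge k n u v j → Edge k n u w j₁ → Edge k n v w j₂ → j ≡ 0
triangle⇒level0 zero (base _ _ _) _ _ = refl
triangle⇒level0 (suc k) {n} uv uw vw with split uv | split uw | split vw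
... | within i _ _ e refl refl | within i₁ _ _ e₁ eu ew | within i₂ _ _ e₂ ev ew′
  with mixed-radix-injective (t k n) i i₁ (proj₁ (edge-bounded e)) (proj₁ (edge-bounded e₁)) eu
     | mixed-radix-injective (t k n) i i₂ (proj₂ (edge-bounded e)) (proj₁ (edge-bounded e₂)) ev
... | refl , refl | refl , refl
  with mixed-radix-injective (t k n) i i (proj₂ (edge-bounded e₁)) (proj₂ (edge-bounded e₂))
         (trans (sym ew) ew′)
... | _ , refl = triangle⇒level0 k e e₁ e₂
triangle⇒level0 (suc k) uv uw vw | within i _ _ e eu ev | within i₁ _ _ e₁ eu₁ ew | bridge br =
  ⊥-elim (bridge-leaves-copy br
    (sameCopy-trans (sameCopy-sym (copy-edge-sameCopy i e eu ev))
                    (copy-edge-sameCopy i₁ e₁ eu₁ ew)))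
triangle⇒level0 (suc k) uv uw vw | within i _ _ e eu ev | bridge br | within i₂ _ _ e₂ ev₂ ew =
  ⊥-elim (bridge-leaves-copy br
    (sameCopy-trans (copy-edge-sameCopy i e eu ev) (copy-edge-sameCopy i₂ e₂ ev₂ ew)))
triangle⇒level0 (suc k) uv uw vw | bridge br | within i₁ _ _ e₁ eu ew | within i₂ _ _ e₂ ev ew₂ =
  ⊥-elim (bridge-leaves-copy br
    (sameCopy-trans (copy-edge-sameCopy i₁ e₁ eu ew)
                    (sameCopy-sym (copy-edge-sameCopy i₂ e₂ ev ew₂))))
triangle⇒level0 (suc k) uv uw vw | bridge u–v | bridge u–w | _ =
  ⊥-elim (edge-irreflexive vw (bridge-unique u–v u–w))
triangle⇒level0 (suc k) uv uw vw | bridge u–v | within _ _ _ _ _ _ | bridge v–w =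
  ⊥-elim (edge-irreflexive uw (bridge-unique (bridge-sym u–v) v–w))
triangle⇒level0 (suc k) uv uw vw | within _ _ _ _ _ _ | bridge u–w | bridge v–w =
  ⊥-elim (edge-irreflexive uv (bridge-unique (bridge-sym u–w) (bridge-sym v–w)))

-- D_{k,n} consists of blocks k n disjoint copies of K_n, the m-th on the vertices m * n + p, p < n.
blocks : ℕ → ℕ → ℕ
blocks zero    n = 1
blocks (suc k) n = blocks k n * suc (t k n)

t≡blocks*n : ∀ k n → t k n ≡ blocks k n * n
t≡blocks*n zero    n = sym (*-identityˡ n)
t≡blocks*n (suc k) n rewrite t≡blocks*n k n = identity (blocks k n) n
  where
  identity : ∀ b n → b * n * suc (b * n) ≡ b * suc (b * n) * n
  identity = solve-∀

block-in-copy : ∀ k n i m p → i * t k n + (m * n + p) ≡ (i * blocks k n + m) * n + p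
block-in-copy k n i m p rewrite t≡blocks*n k n = identity i (blocks k n) n m p
  where
  identity : ∀ i b n m p → i * (b * n) + (m * n + p) ≡ (i * b + m) * n + p
  identity = solve-∀

level0⇒inBlock : ∀ {k n x y} → Edge k n x y 0 →
                 ∃[ m ] ∃[ p ] ∃[ q ] m < blocks k n × p < n × q < n × p ≢ q ×
                                      x ≡ m * n + p × y ≡ m * n + q
level0⇒inBlock (base p<n q<n p≢q) = 0 , _ , _ , s≤s z≤n , p<n , q<n , p≢q , refl , refl
level0⇒inBlock {suc k} {n} (copy i i≤t e) with level0⇒inBlock e
... | m , p , q , m<b , p<n , q<n , p≢q , refl , refl =
  i * blocks k n + m , p , q , mixed-radix-< i≤t m<b , p<n , q<n , p≢q ,
  block-in-copy k n i m p , block-in-copy k n i m q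

inBlock⇒level0 : ∀ k {n m p q} → m < blocks k n → p < n → q < n → p ≢ q →
                 Edge k n (m * n + p) (m * n + q) 0
inBlock⇒level0 zero    {m = zero}  _         p<n q<n p≢q = base p<n q<n p≢q
inBlock⇒level0 zero    {m = suc _} (s≤s ()) _   _   _
inBlock⇒level0 (suc k) {n} {m} {p} {q} m<b p<n q<n p≢q
  with mixed-radix-split {m} {blocks k n} {t k n} m<b
... | i , m′ , i≤t , m′<b , refl =
  subst₂ (λ x y → Edge (suc k) n x y 0) (block-in-copy k n i m′ p) (block-in-copy k n i m′ q)
    (copy i i≤t (inBlock⇒level0 k m′<b p<n q<n p≢q))

level0-neighbour : ∀ {k n} m {p w} → p < n → Edge k n (m * n + p) w 0 →
                   ∃[ r ] r < n × r ≢ p × w ≡ m * n + r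
level0-neighbour {n = n} m p<n e with level0⇒inBlock e
... | m′ , p′ , r , _ , p′<n , r<n , p′≢r , eu , refl
  with mixed-radix-injective n m m′ p<n p′<n eu
... | refl , refl = r , r<n , ≢-sym p′≢r , refl

OtherVertex : ℕ → ℕ → ℕ → ℕ → ℕ → Set
OtherVertex n m p q w = ∃[ r ] r < n × r ≢ p × r ≢ q × w ≡ m * n + r

commonNbr-level0 : ∀ k {n m p q w} → m < blocks k n → p < n → q < n → p ≢ q →
                   OtherVertex n m p q w ⇔ CommonNbr k n (m * n + p) (m * n + q) w
commonNbr-level0 k {n} {m} {p} {q} {w} m<b p<n q<n p≢q = mk⇔ to from
  where
  to : OtherVertex n m p q w → CommonNbr k n (m * n + p) (m * n + q) w
  to (r , r<n , r≢p , r≢q , refl) =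
    (0 , inBlock⇒level0 k m<b p<n r<n (≢-sym r≢p)) ,
    (0 , inBlock⇒level0 k m<b q<n r<n (≢-sym r≢q))

  uv : Edge k n (m * n + p) (m * n + q) 0
  uv = inBlock⇒level0 k m<b p<n q<n p≢q

  from : CommonNbr k n (m * n + p) (m * n + q) w → OtherVertex n m p q w
  from ((_ , uw) , (_ , vw))
    with triangle⇒level0 k uw uv (edge-sym vw) | triangle⇒level0 k vw (edge-sym uv) (edge-sym uw)
  ... | refl | refl with level0-neighbour m p<n uw | level0-neighbour m q<n vw
  ... | r , r<n , r≢p , refl | r′ , _ , r′≢q , w≡ =
    r , r<n , r≢p , subst (_≢ q) (sym (+-cancelˡ-≡ (m * n) r r′ w≡)) r′≢q , refl

module _ {a} {A : Set a} (_≟_ : DecidableEquality A) where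

  remove : A → List A → List A
  remove x = filter (λ y → ¬? (y ≟ x))

  length-remove : ∀ {x xs} → Unique xs → x ∈ xs → suc (length (remove x xs)) ≡ length xs
  length-remove {x} {x ∷ ys} (x∉ys ∷ _) (here refl)
    rewrite filter-reject (λ y → ¬? (y ≟ x)) {x} {ys} (λ x≢x → x≢x refl)
          | filter-all (λ y → ¬? (y ≟ x)) (All.map ≢-sym x∉ys) = refl
  length-remove {x} {y ∷ ys} (y∉ys ∷ ys-unique) (there x∈ys)
    rewrite filter-accept (λ z → ¬? (z ≟ x)) {y} {ys} (All.lookup y∉ys x∈ys) =
    cong suc (length-remove ys-unique x∈ys)

otherVertices : ℕ → ℕ → ℕ → ℕ → List ℕ
otherVertices n m p q = map (m * n +_) (remove _≟_ q (remove _≟_ p (upTo n)))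

otherVertices-unique : ∀ n m p q → Unique (otherVertices n m p q)
otherVertices-unique n m p q =
  map⁺ (+-cancelˡ-≡ (m * n) _ _) (filter⁺ _ (filter⁺ _ (upTo⁺ n)))

length-otherVertices : ∀ {n} m {p q} → p < n → q < n → p ≢ q →
                       length (otherVertices n m p q) ≡ n ∸ 2
length-otherVertices {n} m {p} {q} p<n q<n p≢q =
  trans (length-map (m * n +_) (remove _≟_ q without-p)) (cong (_∸ 2) two+length≡n)
  where
  without-p : List ℕ
  without-p = remove _≟_ p (upTo n)

  q∈without-p : q ∈ without-p
  q∈without-p = ∈-filter⁺ _ (∈-upTo⁺ q<n) (≢-sym p≢q)

  two+length≡n : 2 + length (remove _≟_ q without-p) ≡ n
  two+length≡n = begin
    2 + length (remove _≟_ q without-p)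
      ≡⟨ cong suc (length-remove _≟_ (filter⁺ _ (upTo⁺ n)) q∈without-p) ⟩
    suc (length without-p)
      ≡⟨ length-remove _≟_ (upTo⁺ n) (∈-upTo⁺ p<n) ⟩
    length (upTo n)
      ≡⟨ length-upTo n ⟩
    n ∎
    where open ≡-Reasoning

∈-otherVertices : ∀ {n m p q w} →
                  w ∈ otherVertices n m p q ⇔ OtherVertex n m p q w
∈-otherVertices {n} {m} {p} {q} {w} = mk⇔ to from
  where
  to : w ∈ otherVertices n m p q → ∃[ r ] r < n × r ≢ p × r ≢ q × w ≡ m * n + r
  to w∈ with ∈-map⁻ (m * n +_) w∈
  ... | r , r∈ , refl with ∈-filter⁻ _ r∈
  ...   | r∈′ , r≢q with ∈-filter⁻ _ r∈′
  ...     | r∈upTo , r≢p = r , ∈-upTo⁻ r∈upTo , r≢p , r≢q , refl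
  from : OtherVertex n m p q w → w ∈ otherVertices n m p q
  from (r , r<n , r≢p , r≢q , refl) =
    ∈-map⁺ _ (∈-filter⁺ _ (∈-filter⁺ _ (∈-upTo⁺ r<n) r≢p) r≢q)

lemma5 : ∀ (n k : ℕ) → 2 ≤ n → 1 ≤ k → ∀ (u v j : ℕ) → Edge k n u v j →
    (j ≡ 0 → Σ (List ℕ) λ L → Unique L × length L ≡ n ∸ 2 ×
    (∀ w → (w ∈ L) ⇔ CommonNbr k n u v w))
    × (1 ≤ j → j ≤ k → ∀ w → CommonNbr k n u v w → ⊥)
lemma5 n k _ _ u v j uv = level0 , higher-level
  where
  higher-level : 1 ≤ j → j ≤ k → ∀ w → CommonNbr k n u v w → ⊥
  higher-level 1≤j _ w ((_ , uw) , (_ , vw)) = <⇒≢ 1≤j (sym (triangle⇒level0 k uv uw vw))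

  level0 : j ≡ 0 → Σ (List ℕ) λ L → Unique L × length L ≡ n ∸ 2 ×
                     (∀ w → (w ∈ L) ⇔ CommonNbr k n u v w)
  level0 refl with level0⇒inBlock uv
  ... | m , p , q , m<b , p<n , q<n , p≢q , refl , refl =
    otherVertices n m p q ,
    otherVertices-unique n m p q ,
    length-otherVertices m p<n q<n p≢q ,
    λ w → ⇔-trans (∈-otherVertices {m = m}) (commonNbr-level0 k m<b p<n q<n p≢q)
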